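{- Let $K$ be a number field containing $\sqrt{ -3}$ and $E: y^2=x^3+Ax+B$ an elliptic curve over $K$. For $\lambda \in K^*$ let $l_\lambda$ be the line $6\lambda^2 X + 6\lambda^3 Y + (3A\lambda^4-1)Z = 0$ in $\mathbb{P}^2$, let $$p_\lambda(x) = x^3 - \left(\frac{6\lambda^2 x + 3A\lambda^4 - 1}{6\lambda^3}\right)^2 + Ax + B,$$ and let $\Delta_\lambda$ be the discriminant of $p_\lambda$. Then $\Delta_\lambda$ is a square in $K$ for every $\lambda\in K^*$. Consequently every rational point $[6\lambda^2:6\lambda^3:3A\lambda^4-1]$ ($\lambda\in K^*$) of the curve $\mathcal{Q}_E: a^4 - 3Ab^4 + 6ab^2c=0$ in $(\mathbb{P}^2)^\vee \cong E^2/D_3$ lifts to $K$-rational points on $E^2/(\mathbb{Z}/3\mathbb{Z})$; that is, each of the (at most two) $\mathbb{Z}/3\mathbb{Z}$-orbits contained in the $D_3$-orbit in $E^2$ corresponding to $l_\lambda$ is stable under $\mathrm{Gal}(\overline{K}/K)$.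
   Context: $E$ is embedded in $\mathbb{P}^2$ via $Y^2Z=X^3+AXZ^2+BZ^3$, with $x=X/Z$, $y=Y/Z$; the point $[a:b:c]$ of the dual plane $(\mathbb{P}^2)^\vee$ corresponds to the line $aX+bY+cZ=0$. The dihedral group $D_3=\langle r,s\rangle$ acts on $E^2$ by $r(P,Q)=(Q,-P-Q)$, $s(P,Q)=(P,-P-Q)$, and $\mathbb{Z}/3\mathbb{Z}=\langle r\rangle$. The $D_3$-orbit corresponding to a line $l$ is the set of ordered pairs $(P,Q)$ taken from the three intersection points $P,Q,R$ (with $P+Q+R=O$) of $l$ with $E$; this identifies $E^2/D_3$ with $(\mathbb{P}^2)^\vee$. The roots of $p_\lambda$ are the $x$-coordinates of the points of $l_\lambda\cap E$. -}

module Defs where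

open import Level using (Level; _⊔_) renaming (suc to lsuc)
open import Algebra.Bundles using (CommutativeRing)
open import Algebra.Morphism.Structures using (IsRingHomomorphism)
open import Data.Nat.Base using (ℕ; zero; suc)
open import Data.Fin.Base using (Fin; zero; suc)
open import Data.Product.Base using (Σ; ∃; _,_)
open import Relation.Nullary using (¬_)
import Data.Rational.Base as ℚ

-- A field: a commutative ring with 0 ≠ 1 in which every nonzero element
-- has a multiplicative inverse (the inverse function is total; its value
-- at 0 is irrelevant).
record Field c ℓ : Set (lsuc (c ⊔ ℓ)) where
  field
    commutativeRing : CommutativeRing c ℓ
  open CommutativeRing commutativeRing public
  field
    _⁻¹      : Carrier → Carrier
    ⁻¹-inv   : ∀ x → ¬ (x ≈ 0#) → (x * (x ⁻¹)) ≈ 1#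
    0≉1      : ¬ (0# ≈ 1#)

module _ {c ℓ} (K : Field c ℓ) where
  open Field K using (Carrier; _≈_; _+_; _*_; -_; _-_; 0#; 1#; _⁻¹; rawRing)

  sumK : (n : ℕ) → (Fin n → Carrier) → Carrier
  sumK zero    f = 0#
  sumK (suc n) f = f zero + sumK n (λ i → f (suc i))

  -- K is a number field: a field with a ring homomorphism ℚ → K (so K has
  -- characteristic 0 and is a ℚ-algebra) which is finite-dimensional over ℚ,
  -- i.e. spanned over ℚ by finitely many elements.
  record IsNumberField : Set (c ⊔ ℓ) where
    field
      ι        : ℚ.ℚ → Carrier
      ι-hom    : IsRingHomomorphism ℚ.+-*-rawRing rawRing ι
      dim      : ℕ
      basis    : Fin dim → Carrier
      spanning : ∀ x → ∃ λ (q : Fin dim → ℚ.ℚ) →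
                   x ≈ sumK dim (λ i → ι (q i) * basis i)

  _² : Carrier → Carrier
  x ² = x * x

  _³ : Carrier → Carrier
  x ³ = x * x * x

  2# 3# 4# 6# 18# 27# : Carrier
  2#  = 1# + 1#
  3#  = 2# + 1#
  4#  = 2# + 2#
  6#  = 3# + 3#
  18# = 6# * 3#
  27# = 3# * 3# * 3#

  IsSquare : Carrier → Set (c ⊔ ℓ)
  IsSquare x = ∃ λ d → x ≈ (d * d)

  discMonicCubic : Carrier → Carrier → Carrier → Carrier
  discMonicCubic a b c′ =
    (a ² * b ²) - (4# * b ³) - (4# * a ³ * c′) - (27# * c′ ²) + (18# * a * b * c′)

  -- For λ ≠ 0 put u = 6λ³ and k = 3Aλ⁴ − 1, so that
  --   p_λ(x) = x³ − ((6λ² x + k)/u)² + A x + B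
  --          = x³ + a x² + b x + c  with
  --   a = −36λ⁴/u², b = A − 12λ² k/u², c = B − k²/u².
  module _ (A B l : Carrier) where
    private
      u   = 6# * l ³
      u⁻² = (u ⁻¹) ²
      k   = (3# * A * (l ² * l ²)) - 1#
      m   = 6# * l ²

    pλ-a pλ-b pλ-c : Carrier
    pλ-a = - ((m ²) * u⁻²)
    pλ-b = A - ((2# * m * k) * u⁻²)
    pλ-c = B - ((k ²) * u⁻²)

    Δλ : Carrier
    Δλ = discMonicCubic pλ-a pλ-b pλ-c

{-# OPTIONS --safe #-}
module Submission where

open import Defs
open import Relation.Nullary using (¬_)
open import Data.Product.Base using (∃)

open import Data.Product.Base using (_,_)
open import Data.Bool.Base using (if_then_else_)
open import Data.Maybe.Base using (Maybe; just; nothing)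
open import Data.Integer.Base using (+_)
open import Relation.Nullary using (yes; no; does)
open import Relation.Binary.PropositionalEquality.Core using () renaming (refl to ≡-refl)
import Data.Rational.Base as ℚ
open ℚ using (ℚ; 1ℚ)
import Data.Rational.Properties as ℚ
open import Algebra.Morphism.Structures using (IsRingHomomorphism)
open import Algebra.Solver.Ring.AlmostCommutativeRing
  using (_-Raw-AlmostCommutative⟶_; fromCommutativeRing)
import Algebra.Solver.Ring
import Relation.Binary.Reasoning.Setoid as SetoidReasoning

-- Write t = 1/λ.  Then p_λ has x²-coefficient −t² and x-coefficient t⁴/3 (the A-terms
-- cancel), so p_λ(x) = (x + r)³ + q with r = −t²/3; hence Δ_λ = −27 q² = (3 s q)² where
-- s² = −3.

module FieldProperties {c ℓ} (K : Field c ℓ) where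
  open Field K
  open SetoidReasoning setoid

  x≉0∧y≉0⇒x*y≉0 : ∀ {x y} → ¬ x ≈ 0# → ¬ y ≈ 0# → ¬ x * y ≈ 0#
  x≉0∧y≉0⇒x*y≉0 {x} {y} x≉0 y≉0 xy≈0 = y≉0 (begin
    y                ≈⟨ *-identityˡ y ⟨
    1# * y           ≈⟨ *-congʳ (⁻¹-inv x x≉0) ⟨
    x * x ⁻¹ * y     ≈⟨ *-congʳ (*-comm x (x ⁻¹)) ⟩
    x ⁻¹ * x * y     ≈⟨ *-assoc (x ⁻¹) x y ⟩
    x ⁻¹ * (x * y)   ≈⟨ *-congˡ xy≈0 ⟩
    x ⁻¹ * 0#        ≈⟨ zeroʳ (x ⁻¹) ⟩
    0#               ∎)

  IsSquare-resp-≈ : ∀ {x y} → x ≈ y → IsSquare K y → IsSquare K x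
  IsSquare-resp-≈ x≈y (d , y≈d²) = d , trans x≈y y≈d²

  discMonicCubic-cong : ∀ {a a′ b b′ c′ c″} → a ≈ a′ → b ≈ b′ → c′ ≈ c″ →
                        discMonicCubic K a b c′ ≈ discMonicCubic K a′ b′ c″
  discMonicCubic-cong a≈ b≈ c≈ =
    +-cong (−-cong (−-cong (−-cong (*-cong (²-cong a≈) (²-cong b≈))
                                   (*-congˡ (³-cong b≈)))
                           (*-cong (*-congˡ (³-cong a≈)) c≈))
                   (*-congˡ (²-cong c≈)))
           (*-cong (*-cong (*-congˡ a≈) b≈) c≈)
    where
    −-cong : ∀ {x x′ y y′} → x ≈ x′ → y ≈ y′ → x - y ≈ x′ - y′
    −-cong x≈ y≈ = +-cong x≈ (-‿cong y≈)
    ²-cong : ∀ {x x′} → x ≈ x′ → x * x ≈ x′ * x′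
    ²-cong x≈ = *-cong x≈ x≈
    ³-cong : ∀ {x x′} → x ≈ x′ → x * x * x ≈ x′ * x′ * x′
    ³-cong x≈ = *-cong (²-cong x≈) x≈

module QAlgebraSolver {c ℓ} (K : Field c ℓ) (NF : IsNumberField K) where
  open Field K
  open IsNumberField NF using (ι; ι-hom)
  open IsRingHomomorphism ι-hom using (+-homo; *-homo; -‿homo; 0#-homo; 1#-homo)

  -- φ agrees with ι but sends 1 to 1# on the nose, so that the numerals below,
  -- built from con 1ℚ, denote 2# K, 3# K, … of Defs definitionally.
  φ : ℚ → Carrier
  φ q = if does (q ℚ.≟ 1ℚ) then 1# else ι q

  φ≈ι : ∀ q → φ q ≈ ι q
  φ≈ι q with q ℚ.≟ 1ℚ
  ... | yes ≡-refl = sym 1#-homo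
  ... | no _     = refl

  φ-morphism : ℚ.+-*-rawRing -Raw-AlmostCommutative⟶ fromCommutativeRing commutativeRing
  φ-morphism = record
    { ⟦_⟧    = φ
    ; +-homo = λ p q → trans (φ≈ι _) (trans (+-homo p q) (sym (+-cong (φ≈ι p) (φ≈ι q))))
    ; *-homo = λ p q → trans (φ≈ι _) (trans (*-homo p q) (sym (*-cong (φ≈ι p) (φ≈ι q))))
    ; -‿homo = λ p → trans (φ≈ι _) (trans (-‿homo p) (sym (-‿cong (φ≈ι p))))
    ; 0-homo = trans (φ≈ι _) 0#-homo
    ; 1-homo = refl
    }

  φ-≟ : ∀ p q → Maybe (φ p ≈ φ q)
  φ-≟ p q with p ℚ.≟ q
  ... | yes ≡-refl = just refl
  ... | no _     = nothing

  open Algebra.Solver.Ring ℚ.+-*-rawRing (fromCommutativeRing commutativeRing) φ-morphism φ-≟ public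
    using (Polynomial; con; var; _:+_; _:*_; _:-_; :-_; solve; _:=_)

  one two three six twentyseven : ∀ {n} → Polynomial n
  one         = con 1ℚ
  two         = one :+ one
  three       = two :+ one
  six         = three :+ three
  twentyseven = three :* three :* three

  sq cu : ∀ {n} → Polynomial n → Polynomial n
  sq x = x :* x
  cu x = x :* x :* x

module _ {c ℓ} (K : Field c ℓ) (NF : IsNumberField K) where
  open Field K
  open IsNumberField NF using (ι)
  open FieldProperties K
  open QAlgebraSolver K NF
  open SetoidReasoning setoid

  6#≉0 : ¬ 6# K ≈ 0#
  6#≉0 6≈0 = 0≉1 (begin
    0#                    ≈⟨ zeroʳ (ι (+ 1 ℚ./ 6)) ⟨
    ι (+ 1 ℚ./ 6) * 0#    ≈⟨ *-congˡ 6≈0 ⟨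
    ι (+ 1 ℚ./ 6) * 6# K  ≈⟨ solve 0 (con (+ 1 ℚ./ 6) :* six := one) refl ⟩
    1#                    ∎)

  discMonicCubic-shiftedPureCubic : ∀ r c′ →
    discMonicCubic K (3# K * r) (3# K * (r * r)) c′ ≈ - (27# K * ((c′ - r * r * r) * (c′ - r * r * r)))
  discMonicCubic-shiftedPureCubic = solve 2 (λ r c′ →
    discᴾ (three :* r) (three :* sq r) c′ := :- (twentyseven :* sq (c′ :- cu r))) refl
    where
    discᴾ : ∀ {n} → Polynomial n → Polynomial n → Polynomial n → Polynomial n
    discᴾ a b c′ = (sq a :* sq b) :- ((two :+ two) :* cu b) :- ((two :+ two) :* cu a :* c′)
                   :- (twentyseven :* sq c′) :+ (six :* three :* a :* b :* c′)

  -27*x²-isSquare : (∃ λ s → s * s ≈ - 3# K) → ∀ x → IsSquare K (- (27# K * (x * x)))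
  -27*x²-isSquare (s , s²≈-3) x = s * (3# K * x) , (begin
    - (27# K * (x * x))
      ≈⟨ solve 1 (λ x → :- (twentyseven :* sq x) := (:- three) :* sq (three :* x)) refl x ⟩
    (- 3# K) * ((3# K * x) * (3# K * x))
      ≈⟨ *-congʳ s²≈-3 ⟨
    s * s * ((3# K * x) * (3# K * x))
      ≈⟨ solve 2 (λ s y → sq s :* sq y := sq (s :* y)) refl s (3# K * x) ⟩
    s * (3# K * x) * (s * (3# K * x))
      ∎)

  module LineCubic (A B l : Carrier) (l≉0 : ¬ l ≈ 0#) where
    private
      u w : Carrier
      u = 6# K * (l * l * l)
      w = u ⁻¹

      uw≈1 : u * w ≈ 1#
      uw≈1 = ⁻¹-inv u (x≉0∧y≉0⇒x*y≉0 6#≉0 (x≉0∧y≉0⇒x*y≉0 (x≉0∧y≉0⇒x*y≉0 l≉0 l≉0) l≉0))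

    shift : Carrier
    shift = - (2# K * l * w)

    pλ-a≈3*shift : pλ-a K A B l ≈ 3# K * shift
    pλ-a≈3*shift = begin
      pλ-a K A B l                  ≈⟨ solve 2 (λ l w →
          :- (sq (six :* sq l) :* sq w)
        := :- ((six :* l :* w) :* (six :* cu l :* w))) refl l w ⟩
      - ((6# K * l * w) * (u * w))  ≈⟨ -‿cong (*-congˡ uw≈1) ⟩
      - ((6# K * l * w) * 1#)       ≈⟨ solve 2 (λ l w →
          :- ((six :* l :* w) :* one)
        := three :* :- (two :* l :* w)) refl l w ⟩
      3# K * shift                  ∎

    pλ-b≈3*shift² : pλ-b K A B l ≈ 3# K * (shift * shift)
    pλ-b≈3*shift² = begin
      pλ-b K A B l                                        ≈⟨ solve 3 (λ A l w →
          A :- ((two :* (six :* sq l) :* ((three :* A :* (sq l :* sq l)) :- one)) :* sq w)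
        := A :* (one :- (six :* cu l :* w) :* (six :* cu l :* w)) :+ three :* sq (:- (two :* l :* w)))
        refl A l w ⟩
      A * (1# - u * w * (u * w)) + 3# K * (shift * shift) ≈⟨ +-congʳ (*-congˡ (+-congˡ (-‿cong (*-cong uw≈1 uw≈1)))) ⟩
      A * (1# - 1# * 1#) + 3# K * (shift * shift)         ≈⟨ solve 2 (λ A y → A :* (one :- one :* one) :+ y := y)
                                                               refl A (3# K * (shift * shift)) ⟩
      3# K * (shift * shift)                              ∎

proposition4p3 : ∀ {c ℓ} (K : Field c ℓ) → IsNumberField K →
    (∃ λ s → Field._≈_ K (Field._*_ K s s) (Field.-_ K (3# K))) →
    (A B : Field.Carrier K) →
    ¬ (Field._≈_ K (Field._+_ K (Field._*_ K (4# K) (_³ K A)) (Field._*_ K (27# K) (_² K B))) (Field.0# K)) →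
    (l : Field.Carrier K) → ¬ (Field._≈_ K l (Field.0# K)) →
    IsSquare K (Δλ K A B l)
proposition4p3 K NF -3-isSquare A B _ l l≉0 =
  IsSquare-resp-≈ Δλ≈-27q² (-27*x²-isSquare K NF -3-isSquare q)
  where
  open Field K
  open FieldProperties K
  open LineCubic K NF A B l l≉0
  open SetoidReasoning setoid

  q : Carrier
  q = pλ-c K A B l - shift * shift * shift

  Δλ≈-27q² : Δλ K A B l ≈ - (27# K * (q * q))
  Δλ≈-27q² = begin
    Δλ K A B l
      ≈⟨ discMonicCubic-cong pλ-a≈3*shift pλ-b≈3*shift² refl ⟩
    discMonicCubic K (3# K * shift) (3# K * (shift * shift)) (pλ-c K A B l)
      ≈⟨ discMonicCubic-shiftedPureCubic K NF shift (pλ-c K A B l) ⟩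
    - (27# K * (q * q))
      ∎
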